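{- Let $\mathfrak{Ba}$ be the countable atomless Boolean algebra with universe $B$, regarded as a Boolean ring. Let $l(x_1,\dots,x_k)=x_1+\dots+x_k+\alpha$ with $k\ge0$ and $\alpha\in\{0,1\}$ be a linear term function. Then there exists a unique function $f$ among the eight canonical linear functions $$0,\quad 1,\quad x,\quad \neg x=x+1,\quad +_0(x,y)=x+y,\quad +_1(x,y)=x+y+1,\quad \Sigma(x,y,z)=x+y+z,\quad \Sigma_1(x,y,z)=x+y+z+1$$ such that $l$ and $f$ are first order interdefinable.
   Context: $\mathfrak{Ba}$ is viewed as a Boolean ring $(B,+,\cdot,0,1)$ with $+$ symmetric difference and $\cdot$ meet. Two functions $f,g$ on $B$ are first order interdefinable if $g$ is first order definable in the structure $(B,f)$ and $f$ is first order definable in the structure $(B,g)$. -}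

module Defs where

open import Level using (0ℓ)
open import Data.Nat using (ℕ; zero; suc)
open import Data.Fin using (Fin; zero; suc)
open import Data.Bool using (Bool; true; false)
open import Data.Product using (Σ; ∃; _×_; _,_)
open import Data.Sum using (_⊎_)
open import Data.Empty using (⊥)
open import Relation.Nullary using (¬_; Dec)
open import Relation.Binary.PropositionalEquality using (_≡_)
open import Algebra.Bundles using (CommutativeRing)
open import Function.Bundles using (_⇔_)

record BooleanRing : Set₁ where
  field
    commRing : CommutativeRing 0ℓ 0ℓ
  open CommutativeRing commRing public
  field
    idem : ∀ x → x * x ≈ x

module _ (B : BooleanRing) where
  open BooleanRing B using (Carrier; _≈_; _*_; 0#)

  _≤B_ : Carrier → Carrier → Set
  a ≤B b = a * b ≈ a

  IsAtom : Carrier → Set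
  IsAtom a = ¬ (a ≈ 0#) × (∀ b → b ≤B a → (b ≈ 0#) ⊎ (b ≈ a))

  Atomless : Set
  Atomless = ∀ a → ¬ IsAtom a

  Countable : Set
  Countable = Σ (ℕ → Carrier) λ e → ∀ x → ∃ λ n → e n ≈ x

-- A countable, nontrivial, atomless Boolean ring (i.e. the countable
-- atomless Boolean algebra 𝔅𝔞, unique up to isomorphism).  Decidability
-- of equality is classically automatic.
record CountableAtomlessBR : Set₁ where
  field
    BR        : BooleanRing
  open BooleanRing BR public
  field
    nontrivial : ¬ (0# ≈ 1#)
    atomless   : Atomless BR
    countable  : Countable BR
    _≟B_       : ∀ x y → Dec (x ≈ y)

-- Formulas use the classically complete connectives
-- =, ¬, ∧, ∀ (∨, ∃, → are abbreviations).  Variables are de Bruijn indices.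

data Term (n m : ℕ) : Set where
  var : Fin m → Term n m
  app : (Fin n → Term n m) → Term n m

data Formula (n : ℕ) : ℕ → Set where
  _≐_  : ∀ {m} → Term n m → Term n m → Formula n m
  ¬'_  : ∀ {m} → Formula n m → Formula n m
  _∧'_ : ∀ {m} → Formula n m → Formula n m → Formula n m
  ∀'_  : ∀ {m} → Formula n (suc m) → Formula n m

Op : Set → ℕ → Set
Op A k = (Fin k → A) → A

record Fun (A : Set) : Set where
  constructor fun
  field
    arity : ℕ
    op    : Op A arity

extend : ∀ {A : Set} {m} → A → (Fin m → A) → Fin (suc m) → A
extend a ρ zero    = a
extend a ρ (suc i) = ρ i

module Semantics (B : CountableAtomlessBR) where
  open CountableAtomlessBR B using (Carrier; _≈_; _+_; 0#; 1#)

  eval : ∀ {n m} → Op Carrier n → Term n m → (Fin m → Carrier) → Carrier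
  eval f (var i)  ρ = ρ i
  eval f (app ts) ρ = f (λ i → eval f (ts i) ρ)

  Sat : ∀ {n m} → Op Carrier n → Formula n m → (Fin m → Carrier) → Set
  Sat f (s ≐ t)  ρ = eval f s ρ ≈ eval f t ρ
  Sat f (¬' φ)   ρ = ¬ Sat f φ ρ
  Sat f (φ ∧' ψ) ρ = Sat f φ ρ × Sat f ψ ρ
  Sat f (∀' φ)   ρ = ∀ a → Sat f φ (extend a ρ)

  DefinableIn : Fun Carrier → Fun Carrier → Set
  DefinableIn (fun n f) (fun k g) =
    Σ (Formula n (suc k)) λ φ →
      ∀ (xs : Fin k → Carrier) (y : Carrier) →
        Sat f φ (extend y xs) ⇔ (y ≈ g xs)

  Interdefinable : Fun Carrier → Fun Carrier → Set
  Interdefinable f g = DefinableIn f g × DefinableIn g f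

  sumFin : ∀ k → (Fin k → Carrier) → Carrier
  sumFin zero    xs = 0#
  sumFin (suc k) xs = xs zero + sumFin k (λ i → xs (suc i))

  bit : Bool → Carrier
  bit false = 0#
  bit true  = 1#

  linear : ℕ → Bool → Fun Carrier
  linear k α = fun k (λ xs → sumFin k xs + bit α)

  data Canonical : Set where
    c0 c1 cx c¬x c+₀ c+₁ cΣ cΣ₁ : Canonical

  ⟦_⟧ : Canonical → Fun Carrier
  ⟦ c0  ⟧ = fun 0 (λ _ → 0#)
  ⟦ c1  ⟧ = fun 0 (λ _ → 1#)
  ⟦ cx  ⟧ = fun 1 (λ x → x zero)
  ⟦ c¬x ⟧ = fun 1 (λ x → x zero + 1#)
  ⟦ c+₀ ⟧ = fun 2 (λ x → x zero + x (suc zero))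
  ⟦ c+₁ ⟧ = fun 2 (λ x → (x zero + x (suc zero)) + 1#)
  ⟦ cΣ  ⟧ = fun 3 (λ x → (x zero + x (suc zero)) + x (suc (suc zero)))
  ⟦ cΣ₁ ⟧ = fun 3 (λ x → ((x zero + x (suc zero)) + x (suc (suc zero))) + 1#)

module Submission where

-- Existence.  The canonical function is l with its variables identified
-- (repeated summands cancel in pairs), and l is a nested term in the canonical
-- function; terms give definitions.  Which function occurs depends on whether
-- k = 0, k = 1 or k ≥ 2 is even or odd, and on α.
--
-- Uniqueness.  A congruent involution of B commuting with f commutes with every
-- function definable in (B , f), since satisfaction is invariant under it; so
-- interdefinable functions have the same such symmetries.  Three symmetries
-- read off three bits which together determine a canonical function:
--   complementation x ↦ x + 1        preserves it  iff  its arity is odd,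
--   a shear x ↦ x + χ(x)·v           preserves it  iff  its constant term is 0,
--   the transposition of m and m + 1 preserves it  iff  its arity is ≤ 1.
-- Here χ is an additive {0,1}-valued character with χ(1) = 1, built along a
-- descending chain of nonzero elements deciding an enumeration of B; v is m or
-- m + 1; and m (with a part n of m) is in general position, which atomlessness
-- provides only under double negation.  As the bits have decidable equality,
-- that suffices.

open import Defs
open import Data.Nat using (ℕ; zero; suc; _≤_; _≤′_; ≤′-refl; ≤′-step; _⊔_; s≤s)
open import Data.Nat.Properties using (≤⇒≤′; m≤m⊔n; m≤n⊔m; ≤-refl; ≤-trans)
open import Data.Bool using (Bool; true; false; _xor_)
open import Data.Bool.Properties using (_≟_; xor-identityʳ)
open import Data.Fin using (Fin; zero; suc)
open import Data.Product using (Σ; _×_; _,_; proj₁; proj₂)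
import Data.Product as Product
open import Data.Sum using (_⊎_; inj₁; inj₂)
open import Data.Empty using (⊥-elim)
open import Function using (_∘_)
open import Function.Bundles using (_⇔_; mk⇔; Equivalence)
open import Function.Properties.Equivalence using () renaming (sym to ⇔-sym; trans to ⇔-trans)
open import Relation.Nullary using (¬_; yes; no)
open import Relation.Nullary.Negation using (¬¬-map)
open import Relation.Nullary.Decidable using (decidable-stable)
open import Relation.Nullary.Reflects using (Reflects; ofʸ; ofⁿ; det)
open import Relation.Binary.PropositionalEquality as ≡ using (_≡_)
import Relation.Binary.Reasoning.Setoid as SetoidReasoning
import Algebra.Properties.Group as GroupProperties
import Algebra.Solver.CommutativeMonoid as CommutativeMonoidSolver

open Equivalence using (to; from)

-- Twice a number, by recursion, so that double (suc j) unfolds to two successors.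
double : ℕ → ℕ
double zero    = zero
double (suc j) = suc (suc (double j))

data Parity : ℕ → Set where
  even : ∀ j → Parity (double j)
  odd  : ∀ j → Parity (suc (double j))

parity : ∀ k → Parity k
parity zero = even zero
parity (suc k) with parity k
... | even j = odd j
... | odd j  = even (suc j)

reflects-⇔ : ∀ {P Q : Set} {b} → P ⇔ Q → Reflects P b → Reflects Q b
reflects-⇔ P⇔Q (ofʸ p)  = ofʸ (to P⇔Q p)
reflects-⇔ P⇔Q (ofⁿ ¬p) = ofⁿ (¬p ∘ from P⇔Q)

module Proof (B : CountableAtomlessBR) where
  open CountableAtomlessBR B hiding (zero)
  open Semantics B
  open SetoidReasoning setoid
  open GroupProperties +-group using (∙-cancelˡ)
  open CommutativeMonoidSolver +-commutativeMonoid using (solve; _⊜_; _⊕_)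

  -- Characteristic 2: x + x = (x + x)² = (x + x) + (x + x), so x + x = 0.
  x+x≈0 : ∀ x → x + x ≈ 0#
  x+x≈0 x = ∙-cancelˡ (x + x) (x + x) 0# (begin
    (x + x) + (x + x)                  ≈⟨ +-cong (+-cong (sym (idem x)) (sym (idem x)))
                                                 (+-cong (sym (idem x)) (sym (idem x))) ⟩
    (x * x + x * x) + (x * x + x * x)  ≈⟨ sym (+-cong (distribʳ x x x) (distribʳ x x x)) ⟩
    (x + x) * x + (x + x) * x          ≈⟨ sym (distribˡ (x + x) x x) ⟩
    (x + x) * (x + x)                  ≈⟨ idem (x + x) ⟩
    x + x                              ≈⟨ sym (+-identityʳ (x + x)) ⟩
    (x + x) + 0#                       ∎)

  x+[y+y]≈x : ∀ x y → x + (y + y) ≈ x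
  x+[y+y]≈x x y = trans (+-cong refl (x+x≈0 y)) (+-identityʳ x)

  x+1+1≈x : ∀ x → (x + 1#) + 1# ≈ x
  x+1+1≈x x = trans (+-assoc x 1# 1#) (x+[y+y]≈x x 1#)

  -- Each element is its own negative, so an equation can be solved by adding.
  x+y≈z⇒x≈z+y : ∀ x y z → x + y ≈ z → x ≈ z + y
  x+y≈z⇒x≈z+y x y z x+y≈z = begin
    x             ≈⟨ sym (x+[y+y]≈x x y) ⟩
    x + (y + y)   ≈⟨ sym (+-assoc x y y) ⟩
    (x + y) + y   ≈⟨ +-cong x+y≈z refl ⟩
    z + y         ∎

  x+1≈y+1⇒x≈y : ∀ {x y} → x + 1# ≈ y + 1# → x ≈ y
  x+1≈y+1⇒x≈y {x} {y} x+1≈y+1 = trans (x+y≈z⇒x≈z+y x 1# _ x+1≈y+1) (x+1+1≈x y)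

  x+d≈x⇒d≈0 : ∀ x d → x + d ≈ x → d ≈ 0#
  x+d≈x⇒d≈0 x d x+d≈x = ∙-cancelˡ x d 0# (trans x+d≈x (sym (+-identityʳ x)))

  1≉0 : ¬ 1# ≈ 0#
  1≉0 1≈0 = nontrivial (sym 1≈0)

  Congruent : ∀ {k} → Op Carrier k → Set
  Congruent f = ∀ xs ys → (∀ i → xs i ≈ ys i) → f xs ≈ f ys

  record Involution : Set where
    field
      π            : Carrier → Carrier
      π-cong       : ∀ {x y} → x ≈ y → π x ≈ π y
      π-involutive : ∀ x → π (π x) ≈ x

    π-injective : ∀ {x y} → π x ≈ π y → x ≈ y
    π-injective πx≈πy = trans (sym (π-involutive _)) (trans (π-cong πx≈πy) (π-involutive _))

  Preserves : Involution → Fun Carrier → Set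
  Preserves I (fun k f) = ∀ xs → π (f xs) ≈ f (π ∘ xs)
    where open Involution I

  broken : ∀ I {k} {f : Op Carrier k} xs d → ¬ d ≈ 0# →
           Involution.π I (f xs) ≈ f (Involution.π I ∘ xs) + d → ¬ Preserves I (fun k f)
  broken I xs d d≉0 differ preserved =
    d≉0 (x+d≈x⇒d≈0 _ d (sym (trans (sym (preserved xs)) differ)))

  module Invariance (I : Involution) {n} (f : Op Carrier n) (f-cong : Congruent f)
                    (f-preserved : Preserves I (fun n f)) where
    open Involution I

    _↦_ : ∀ {m} → (Fin m → Carrier) → (Fin m → Carrier) → Set
    ρ ↦ ρ′ = ∀ i → ρ′ i ≈ π (ρ i)

    ↦-extend : ∀ {m} {ρ ρ′ : Fin m → Carrier} {a b} → b ≈ π a → ρ ↦ ρ′ → extend a ρ ↦ extend b ρ′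
    ↦-extend b≈πa ρ↦ρ′ zero    = b≈πa
    ↦-extend b≈πa ρ↦ρ′ (suc i) = ρ↦ρ′ i

    eval-invariant : ∀ {m} (t : Term n m) {ρ ρ′} → ρ ↦ ρ′ → eval f t ρ′ ≈ π (eval f t ρ)
    eval-invariant (var i)  ρ↦ρ′ = ρ↦ρ′ i
    eval-invariant (app ts) ρ↦ρ′ =
      trans (f-cong _ _ (λ i → eval-invariant (ts i) ρ↦ρ′)) (sym (f-preserved _))

    sat-invariant : ∀ {m} (φ : Formula n m) {ρ ρ′} → ρ ↦ ρ′ → Sat f φ ρ ⇔ Sat f φ ρ′
    sat-invariant (s ≐ t) ρ↦ρ′ = mk⇔
      (λ s≈t → trans (eval-invariant s ρ↦ρ′) (trans (π-cong s≈t) (sym (eval-invariant t ρ↦ρ′))))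
      (λ s′≈t′ → π-injective (trans (sym (eval-invariant s ρ↦ρ′)) (trans s′≈t′ (eval-invariant t ρ↦ρ′))))
    sat-invariant (¬' φ) ρ↦ρ′ = mk⇔
      (λ ¬holds holds′ → ¬holds (from (sat-invariant φ ρ↦ρ′) holds′))
      (λ ¬holds′ holds → ¬holds′ (to (sat-invariant φ ρ↦ρ′) holds))
    sat-invariant (φ ∧' ψ) ρ↦ρ′ = mk⇔
      (Product.map (to (sat-invariant φ ρ↦ρ′)) (to (sat-invariant ψ ρ↦ρ′)))
      (Product.map (from (sat-invariant φ ρ↦ρ′)) (from (sat-invariant ψ ρ↦ρ′)))
    sat-invariant (∀' φ) ρ↦ρ′ = mk⇔
      (λ ∀φ b → to (sat-invariant φ (↦-extend (sym (π-involutive b)) ρ↦ρ′)) (∀φ (π b)))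
      (λ ∀φ′ a → from (sat-invariant φ (↦-extend refl ρ↦ρ′)) (∀φ′ (π a)))

  definable-preserved : ∀ I {F G} → Congruent (Fun.op F) → DefinableIn F G → Preserves I F → Preserves I G
  definable-preserved I {fun n f} {fun k g} f-cong (φ , defines) f-preserved xs =
    to (defines (π ∘ xs) (π (g xs)))
       (to (sat-invariant φ (↦-extend refl (λ _ → refl))) (from (defines xs (g xs)) refl))
    where
    open Involution I
    open Invariance I f f-cong f-preserved

  interdefinable-preserved : ∀ I {F G} → Congruent (Fun.op F) → Congruent (Fun.op G) →
                             Interdefinable F G → Preserves I F ⇔ Preserves I G
  interdefinable-preserved I F-cong G-cong (F⇒G , G⇒F) =
    mk⇔ (definable-preserved I F-cong F⇒G) (definable-preserved I G-cong G⇒F)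

  -- The input variables x₁ … x_k of a defining formula φ(y, x₁, …, x_k).
  input : ∀ {n k} → Fin k → Term n (suc k)
  input i = var (suc i)

  term-definable : ∀ {n k} (f : Op Carrier n) (g : Op Carrier k) (t : Term n (suc k)) →
                   (∀ xs y → eval f t (extend y xs) ≈ g xs) → DefinableIn (fun n f) (fun k g)
  term-definable f g t t≈g = (var zero ≐ t) , λ xs y →
    mk⇔ (λ y≈t → trans y≈t (t≈g xs y)) (λ y≈g → trans y≈g (sym (t≈g xs y)))

  pointwise-interdefinable : ∀ {k} (f g : Op Carrier k) → (∀ xs → f xs ≈ g xs) →
                             Interdefinable (fun k f) (fun k g)
  pointwise-interdefinable f g f≈g =
    term-definable f g (app input) (λ xs _ → f≈g xs) ,
    term-definable g f (app input) (λ xs _ → sym (f≈g xs))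

  copies : ℕ → Carrier → Carrier
  copies n z = sumFin n (λ _ → z)

  copies-even : ∀ j z → copies (double j) z ≈ 0#
  copies-even zero    z = refl
  copies-even (suc j) z = begin
    z + (z + copies (double j) z)   ≈⟨ sym (+-assoc z z _) ⟩
    (z + z) + copies (double j) z   ≈⟨ +-cong (x+x≈0 z) (copies-even j z) ⟩
    0# + 0#                         ≈⟨ +-identityʳ 0# ⟩
    0#                              ∎

  copies-odd : ∀ j z → copies (suc (double j)) z ≈ z
  copies-odd j z = trans (+-cong refl (copies-even j z)) (+-identityʳ z)

  pair : ∀ {m} → Term 2 m → Term 2 m → Term 2 m
  pair s t = app (extend s λ _ → t)

  triple : ∀ {m} → Term 3 m → Term 3 m → Term 3 m → Term 3 m
  triple s t u = app (extend s (extend t λ _ → u))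

  -- From g(x, y) = x + y + a, a term computing x₁ + … + x_{2j+2} + a: it uses
  -- 2j + 1 applications of g, so the summands a cancel down to one.
  even-chain : ∀ j {m} → (Fin (suc (suc (double j))) → Term 2 m) → Term 2 m
  even-chain zero    ts = pair (ts zero) (ts (suc zero))
  even-chain (suc j) ts = pair (pair (ts zero) (ts (suc zero))) (even-chain j (λ i → ts (suc (suc i))))

  even-chain-sum : ∀ a (g : Op Carrier 2) → (∀ zs → g zs ≈ (zs zero + zs (suc zero)) + a) →
                   ∀ j {m} (ts : Fin (suc (suc (double j))) → Term 2 m) ρ →
                   eval g (even-chain j ts) ρ ≈ sumFin (suc (suc (double j))) (λ i → eval g (ts i) ρ) + a
  even-chain-sum a g g-spec zero ts ρ =
    trans (g-spec _) (+-cong (+-cong refl (sym (+-identityʳ _))) refl)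
  even-chain-sum a g g-spec (suc j) ts ρ = begin
    eval g (even-chain (suc j) ts) ρ
      ≈⟨ trans (g-spec _)
           (+-cong (+-cong (g-spec _) (even-chain-sum a g g-spec j (λ i → ts (suc (suc i))) ρ)) refl) ⟩
    (((x + y) + a) + (s + a)) + a
      ≈⟨ solve 4 (λ x y s a → (((x ⊕ y) ⊕ a) ⊕ (s ⊕ a)) ⊕ a
                              ⊜ ((x ⊕ (y ⊕ s)) ⊕ a) ⊕ (a ⊕ a)) refl x y s a ⟩
    ((x + (y + s)) + a) + (a + a)
      ≈⟨ x+[y+y]≈x _ a ⟩
    (x + (y + s)) + a ∎
    where
    x = eval g (ts zero) ρ
    y = eval g (ts (suc zero)) ρ
    s = sumFin (suc (suc (double j))) (λ i → eval g (ts (suc (suc i))) ρ)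

  -- From g(x, y, z) = x + y + z + a, a term computing x₁ + … + x_{2j+3} + a:
  -- each step adds two applications, g(g(x₁, x₂, rest), x₁, x₁).
  odd-chain : ∀ j {m} → (Fin (suc (suc (suc (double j)))) → Term 3 m) → Term 3 m
  odd-chain zero    ts = triple (ts zero) (ts (suc zero)) (ts (suc (suc zero)))
  odd-chain (suc j) ts =
    triple (triple (ts zero) (ts (suc zero)) (odd-chain j (λ i → ts (suc (suc i))))) (ts zero) (ts zero)

  odd-chain-sum : ∀ a (g : Op Carrier 3) →
                  (∀ zs → g zs ≈ ((zs zero + zs (suc zero)) + zs (suc (suc zero))) + a) →
                  ∀ j {m} (ts : Fin (suc (suc (suc (double j)))) → Term 3 m) ρ →
                  eval g (odd-chain j ts) ρ ≈ sumFin (suc (suc (suc (double j)))) (λ i → eval g (ts i) ρ) + a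
  odd-chain-sum a g g-spec zero ts ρ =
    trans (g-spec _) (+-cong (trans (+-assoc _ _ _) (+-cong refl (+-cong refl (sym (+-identityʳ _))))) refl)
  odd-chain-sum a g g-spec (suc j) ts ρ = begin
    eval g (odd-chain (suc j) ts) ρ
      ≈⟨ trans (g-spec _) (+-cong (+-cong (+-cong (trans (g-spec _)
           (+-cong (+-cong refl (odd-chain-sum a g g-spec j (λ i → ts (suc (suc i))) ρ)) refl)) refl) refl) refl) ⟩
    (((((x + y) + (s + a)) + a) + x) + x) + a
      ≈⟨ solve 4 (λ x y s a → (((((x ⊕ y) ⊕ (s ⊕ a)) ⊕ a) ⊕ x) ⊕ x) ⊕ a
                              ⊜ (((x ⊕ (y ⊕ s)) ⊕ a) ⊕ (a ⊕ a)) ⊕ (x ⊕ x)) refl x y s a ⟩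
    (((x + (y + s)) + a) + (a + a)) + (x + x)
      ≈⟨ trans (x+[y+y]≈x _ x) (x+[y+y]≈x _ a) ⟩
    (x + (y + s)) + a ∎
    where
    x = eval g (ts zero) ρ
    y = eval g (ts (suc zero)) ρ
    s = sumFin (suc (suc (suc (double j)))) (λ i → eval g (ts (suc (suc i))) ρ)

  -- For k = 2j + 2, l is interdefinable with any g(x, y) = x + y + α:
  -- g(x, y) = l(x, y, …, y) and l is an even chain of g.
  even-interdefinable : ∀ j α (g : Op Carrier 2) → (∀ zs → g zs ≈ (zs zero + zs (suc zero)) + bit α) →
                        Interdefinable (linear (suc (suc (double j))) α) (fun 2 g)
  even-interdefinable j α g g-spec =
    term-definable _ g (app (extend (input zero) λ _ → input (suc zero)))
      (λ xs _ → trans (+-cong (+-cong refl (copies-odd j _)) refl) (sym (g-spec xs))) ,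
    term-definable g _ (even-chain j input) (λ xs y → even-chain-sum (bit α) g g-spec j input (extend y xs))

  -- For k = 2j + 3, l is interdefinable with any g(x, y, z) = x + y + z + α:
  -- g(x, y, z) = l(x, y, z, …, z) and l is an odd chain of g.
  odd-interdefinable : ∀ j α (g : Op Carrier 3) →
                       (∀ zs → g zs ≈ ((zs zero + zs (suc zero)) + zs (suc (suc zero))) + bit α) →
                       Interdefinable (linear (suc (suc (suc (double j)))) α) (fun 3 g)
  odd-interdefinable j α g g-spec =
    term-definable _ g (app (extend (input zero) (extend (input (suc zero)) λ _ → input (suc (suc zero)))))
      (λ xs _ → trans (+-cong (trans (+-cong refl (+-cong refl (copies-odd j _))) (sym (+-assoc _ _ _))) refl)
                      (sym (g-spec xs))) ,
    term-definable g _ (odd-chain j input) (λ xs y → odd-chain-sum (bit α) g g-spec j input (extend y xs))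

  even-case : ∀ j α → Σ Canonical λ c → Interdefinable (linear (suc (suc (double j))) α) ⟦ c ⟧
  even-case j false = c+₀ , even-interdefinable j false _ (λ _ → sym (+-identityʳ _))
  even-case j true  = c+₁ , even-interdefinable j true  _ (λ _ → refl)

  odd-case : ∀ j α → Σ Canonical λ c → Interdefinable (linear (suc (suc (suc (double j)))) α) ⟦ c ⟧
  odd-case j false = cΣ  , odd-interdefinable j false _ (λ _ → sym (+-identityʳ _))
  odd-case j true  = cΣ₁ , odd-interdefinable j true  _ (λ _ → refl)

  existence : ∀ k α → Σ Canonical λ c → Interdefinable (linear k α) ⟦ c ⟧
  existence zero       false = c0  , pointwise-interdefinable _ _ (λ _ → +-identityʳ 0#)
  existence zero       true  = c1  , pointwise-interdefinable _ _ (λ _ → +-identityˡ 1#)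
  existence (suc zero) false = cx  , pointwise-interdefinable _ _ (λ _ → trans (+-identityʳ _) (+-identityʳ _))
  existence (suc zero) true  = c¬x , pointwise-interdefinable _ _ (λ _ → +-cong (+-identityʳ _) refl)
  existence (suc (suc k)) α with parity k
  ... | even j = even-case j α
  ... | odd  j = odd-case j α

  _⊑_ : Carrier → Carrier → Set
  _⊑_ = _≤B_ BR

  ⊑-trans : ∀ {p q r} → p ⊑ q → q ⊑ r → p ⊑ r
  ⊑-trans {p} {q} {r} p⊑q q⊑r = begin
    p * r        ≈⟨ *-cong (sym p⊑q) refl ⟩
    p * q * r    ≈⟨ *-assoc p q r ⟩
    p * (q * r)  ≈⟨ *-cong refl q⊑r ⟩
    p * q        ≈⟨ p⊑q ⟩
    p            ∎

  proper-part : ∀ a → ¬ a ≈ 0# → ¬ ¬ (Σ Carrier λ b → b ⊑ a × ¬ b ≈ 0# × ¬ b ≈ a)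
  proper-part a a≉0 no-part = atomless a (a≉0 , trivial-parts)
    where
    trivial-parts : ∀ b → b ⊑ a → b ≈ 0# ⊎ b ≈ a
    trivial-parts b b⊑a with b ≟B 0# | b ≟B a
    ... | yes b≈0 | _       = inj₁ b≈0
    ... | no _    | yes b≈a = inj₂ b≈a
    ... | no b≉0  | no b≉a  = ⊥-elim (no-part (b , b⊑a , b≉0 , b≉a))

  record GeneralPosition : Set where
    field
      m n   : Carrier
      m≉0   : ¬ m ≈ 0#
      m≉1   : ¬ m ≈ 1#
      n≉0   : ¬ n ≈ 0#
      n≉1   : ¬ n ≈ 1#
      n≉m   : ¬ n ≈ m
      n≉m+1 : ¬ n ≈ m + 1#

  -- m is a proper part of 1 and n a proper part of m.
  general-position : ¬ ¬ GeneralPosition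
  general-position no-position =
    proper-part 1# 1≉0 λ (m , _ , m≉0 , m≉1) →
    proper-part m m≉0 λ (n , n⊑m , n≉0 , n≉m) → no-position record
      { m = m ; n = n ; m≉0 = m≉0 ; m≉1 = m≉1 ; n≉0 = n≉0 ; n≉m = n≉m
      ; n≉1   = λ n≈1 → n≉m (sym (begin
          m       ≈⟨ sym (*-identityˡ m) ⟩
          1# * m  ≈⟨ *-cong (sym n≈1) refl ⟩
          n * m   ≈⟨ n⊑m ⟩
          n       ∎))
      ; n≉m+1 = λ n≈m+1 → n≉0 (begin
          n                ≈⟨ sym n⊑m ⟩
          n * m            ≈⟨ *-cong n≈m+1 refl ⟩
          (m + 1#) * m     ≈⟨ distribʳ m m 1# ⟩
          m * m + 1# * m   ≈⟨ +-cong (idem m) (*-identityˡ m) ⟩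
          m + m            ≈⟨ x+x≈0 m ⟩
          0#               ∎)
      }

  enum : ℕ → Carrier
  enum = proj₁ countable

  index : Carrier → ℕ
  index x = proj₁ (proj₂ countable x)

  enum-index : ∀ x → enum (index x) ≈ x
  enum-index x = proj₂ (proj₂ countable x)

  _·_ : Bool → Carrier → Carrier
  true  · s = s
  false · s = 0#

  ·-xor : ∀ t t′ s → (t xor t′) · s ≈ t · s + t′ · s
  ·-xor true  true  s = sym (x+x≈0 s)
  ·-xor true  false s = sym (+-identityʳ s)
  ·-xor false true  s = sym (+-identityˡ s)
  ·-xor false false s = sym (+-identityʳ 0#)

  ·-injective : ∀ {s} t t′ → ¬ s ≈ 0# → t · s ≈ t′ · s → t ≡ t′
  ·-injective true  true  s≉0 _   = ≡.refl
  ·-injective true  false s≉0 s≈0 = ⊥-elim (s≉0 s≈0)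
  ·-injective false true  s≉0 0≈s = ⊥-elim (s≉0 (sym 0≈s))
  ·-injective false false s≉0 _   = ≡.refl

  -- b decides x as t: b lies inside x (t = true) or is disjoint from x (t = false).
  Decides : Carrier → Carrier → Bool → Set
  Decides b x t = b * x ≈ t · b

  decides-⊑ : ∀ {p q x} t → p ⊑ q → Decides q x t → Decides p x t
  decides-⊑ {p} {q} {x} t p⊑q q-decides = begin
    p * x        ≈⟨ *-cong (sym p⊑q) refl ⟩
    p * q * x    ≈⟨ *-assoc p q x ⟩
    p * (q * x)  ≈⟨ *-cong refl q-decides ⟩
    p * (t · q)  ≈⟨ scaled t ⟩
    t · p        ∎
    where
    scaled : ∀ t → p * (t · q) ≈ t · p
    scaled true  = p⊑q
    scaled false = zeroʳ p

  refine : Carrier → Carrier → Carrier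
  refine b x with (b * x) ≟B 0#
  ... | yes _ = b
  ... | no  _ = b * x

  refine-nonzero : ∀ b x → ¬ b ≈ 0# → ¬ refine b x ≈ 0#
  refine-nonzero b x b≉0 with (b * x) ≟B 0#
  ... | yes _   = b≉0
  ... | no bx≉0 = bx≉0

  refine-⊑ : ∀ b x → refine b x ⊑ b
  refine-⊑ b x with (b * x) ≟B 0#
  ... | yes _ = idem b
  ... | no  _ = trans (*-comm (b * x) b) (trans (sym (*-assoc b b x)) (*-cong (idem b) refl))

  refine-decides : ∀ b x → Σ Bool (Decides (refine b x) x)
  refine-decides b x with (b * x) ≟B 0#
  ... | yes bx≈0 = false , bx≈0
  ... | no  _    = true , trans (*-assoc b x x) (*-cong refl (idem x))

  -- A descending chain of nonzero elements whose (j + 1)-th member decides enum j.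
  chain : ℕ → Carrier
  chain zero    = 1#
  chain (suc j) = refine (chain j) (enum j)

  chain-nonzero : ∀ j → ¬ chain j ≈ 0#
  chain-nonzero zero    = 1≉0
  chain-nonzero (suc j) = refine-nonzero (chain j) (enum j) (chain-nonzero j)

  chain-descending : ∀ {i j} → i ≤′ j → chain j ⊑ chain i
  chain-descending ≤′-refl         = idem _
  chain-descending (≤′-step {j} i≤j) = ⊑-trans (refine-⊑ (chain j) (enum j)) (chain-descending i≤j)

  -- The character χ: the way the chain decides x.  (It is the indicator of the
  -- ultrafilter generated by the chain.)
  character : Carrier → Bool
  character x = proj₁ (refine-decides (chain (index x)) (enum (index x)))

  character-decides : ∀ x {j} → suc (index x) ≤ j → Decides (chain j) x (character x)
  character-decides x {j} index<j =
    decides-⊑ (character x) (chain-descending (≤⇒≤′ index<j))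
      (trans (*-cong refl (sym (enum-index x)))
             (proj₂ (refine-decides (chain (index x)) (enum (index x)))))

  -- Any late chain member determines χ(x), since chain members are nonzero.
  character-unique : ∀ x {j} t → suc (index x) ≤ j → Decides (chain j) x t → character x ≡ t
  character-unique x {j} t index<j decides =
    ·-injective (character x) t (chain-nonzero j) (trans (sym (character-decides x index<j)) decides)

  character-cong : ∀ {x y} → x ≈ y → character x ≡ character y
  character-cong {x} {y} x≈y = ≡.sym (character-unique y (character x) (s≤s (m≤n⊔m (index x) (index y)))
    (trans (*-cong refl (sym x≈y)) (character-decides x (s≤s (m≤m⊔n (index x) (index y))))))

  character-0 : character 0# ≡ false
  character-0 = character-unique 0# false ≤-refl (zeroʳ _)

  character-1 : character 1# ≡ true
  character-1 = character-unique 1# true ≤-refl (*-identityʳ _)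

  character-+ : ∀ x y → character (x + y) ≡ character x xor character y
  character-+ x y =
    character-unique (x + y) (character x xor character y) (s≤s (m≤n⊔m _ (index (x + y)))) (begin
      chain j * (x + y)                              ≈⟨ distribˡ (chain j) x y ⟩
      chain j * x + chain j * y                      ≈⟨ +-cong (character-decides x (s≤s x≤bound))
                                                               (character-decides y (s≤s y≤bound)) ⟩
      character x · chain j + character y · chain j  ≈⟨ sym (·-xor (character x) (character y) (chain j)) ⟩
      (character x xor character y) · chain j        ∎)
    where
    bound = index x ⊔ index y ⊔ index (x + y)
    j     = suc bound
    x≤bound = ≤-trans (m≤m⊔n (index x) (index y)) (m≤m⊔n _ (index (x + y)))
    y≤bound = ≤-trans (m≤n⊔m (index x) (index y)) (m≤m⊔n _ (index (x + y)))

  canonical-cong : ∀ c → Congruent (Fun.op ⟦ c ⟧)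
  canonical-cong c0  xs ys xs≈ys = refl
  canonical-cong c1  xs ys xs≈ys = refl
  canonical-cong cx  xs ys xs≈ys = xs≈ys zero
  canonical-cong c¬x xs ys xs≈ys = +-cong (xs≈ys zero) refl
  canonical-cong c+₀ xs ys xs≈ys = +-cong (xs≈ys zero) (xs≈ys (suc zero))
  canonical-cong c+₁ xs ys xs≈ys = +-cong (+-cong (xs≈ys zero) (xs≈ys (suc zero))) refl
  canonical-cong cΣ  xs ys xs≈ys = +-cong (+-cong (xs≈ys zero) (xs≈ys (suc zero))) (xs≈ys (suc (suc zero)))
  canonical-cong cΣ₁ xs ys xs≈ys =
    +-cong (+-cong (+-cong (xs≈ys zero) (xs≈ys (suc zero))) (xs≈ys (suc (suc zero)))) refl

  sumFin-cong : ∀ k xs ys → (∀ i → xs i ≈ ys i) → sumFin k xs ≈ sumFin k ys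
  sumFin-cong zero    xs ys xs≈ys = refl
  sumFin-cong (suc k) xs ys xs≈ys = +-cong (xs≈ys zero) (sumFin-cong k _ _ (λ i → xs≈ys (suc i)))

  linear-cong : ∀ k α → Congruent (Fun.op (linear k α))
  linear-cong k α xs ys xs≈ys = +-cong (sumFin-cong k xs ys xs≈ys) refl

  odd-arity no-constant at-most-unary : Canonical → Bool
  odd-arity c0  = false
  odd-arity c1  = false
  odd-arity cx  = true
  odd-arity c¬x = true
  odd-arity c+₀ = false
  odd-arity c+₁ = false
  odd-arity cΣ  = true
  odd-arity cΣ₁ = true
  no-constant c0  = true
  no-constant c1  = false
  no-constant cx  = true
  no-constant c¬x = false
  no-constant c+₀ = true
  no-constant c+₁ = false
  no-constant cΣ  = true
  no-constant cΣ₁ = false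
  at-most-unary c0  = true
  at-most-unary c1  = true
  at-most-unary cx  = true
  at-most-unary c¬x = true
  at-most-unary c+₀ = false
  at-most-unary c+₁ = false
  at-most-unary cΣ  = false
  at-most-unary cΣ₁ = false

  complement : Involution
  complement = record { π = _+ 1# ; π-cong = λ x≈y → +-cong x≈y refl ; π-involutive = x+1+1≈x }

  sum-complement : ∀ x y z → ((x + 1#) + (y + 1#)) + (z + 1#) ≈ ((x + y) + z) + 1#
  sum-complement x y z = trans
    (solve 4 (λ x y z o → ((x ⊕ o) ⊕ (y ⊕ o)) ⊕ (z ⊕ o) ⊜ (((x ⊕ y) ⊕ z) ⊕ o) ⊕ (o ⊕ o)) refl x y z 1#)
    (x+[y+y]≈x _ 1#)

  zeros-complemented : 0# + 0# ≈ (0# + 1#) + (0# + 1#)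
  zeros-complemented = trans (+-identityʳ 0#) (sym (x+x≈0 (0# + 1#)))

  complement-reflects : ∀ c → Reflects (Preserves complement ⟦ c ⟧) (odd-arity c)
  complement-reflects c0  = ofⁿ (broken complement (λ ()) 1# 1≉0 refl)
  complement-reflects c1  = ofⁿ (broken complement (λ ()) 1# 1≉0 refl)
  complement-reflects cx  = ofʸ (λ _ → refl)
  complement-reflects c¬x = ofʸ (λ _ → refl)
  complement-reflects c+₀ = ofⁿ (broken complement (λ _ → 0#) 1# 1≉0 (+-cong zeros-complemented refl))
  complement-reflects c+₁ =
    ofⁿ (broken complement (λ _ → 0#) 1# 1≉0 (+-cong (+-cong zeros-complemented refl) refl))
  complement-reflects cΣ  = ofʸ (λ xs → sym (sum-complement _ _ _))
  complement-reflects cΣ₁ = ofʸ (λ xs → sym (+-cong (sum-complement _ _ _) refl))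

  ShearVector : Set
  ShearVector = Σ Carrier λ v → ¬ v ≈ 0# × character v ≡ false

  -- Given m ∉ {0, 1}, either m or m + 1 is a shear vector, as χ(m + 1) = χ(m) xor 1.
  shear-vector : ∀ m → ¬ m ≈ 0# → ¬ m ≈ 1# → ShearVector
  shear-vector m m≉0 m≉1 with character m in χm
  ... | false = m , m≉0 , χm
  ... | true  = m + 1# , (λ m+1≈0 → m≉1 (trans (x+y≈z⇒x≈z+y m 1# 0# m+1≈0) (+-identityˡ 1#))) ,
                ≡.trans (character-+ m 1#) (≡.cong₂ _xor_ χm character-1)

  -- The shear x ↦ x + χ(x)·v along a shear vector v: an additive involution
  -- fixing 0 but moving 1 to 1 + v.
  module Shear (V : ShearVector) where

    v : Carrier
    v = proj₁ V

    v≉0 : ¬ v ≈ 0#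
    v≉0 = proj₁ (proj₂ V)

    χv≡false : character v ≡ false
    χv≡false = proj₂ (proj₂ V)

    σ : Carrier → Carrier
    σ x = x + character x · v

    character-σ : ∀ x → character (σ x) ≡ character x
    character-σ x = ≡.trans (character-+ x _)
      (≡.trans (≡.cong (character x xor_) (vanishes (character x))) (xor-identityʳ _))
      where
      vanishes : ∀ t → character (t · v) ≡ false
      vanishes true  = χv≡false
      vanishes false = character-0

    σ-cong : ∀ {x y} → x ≈ y → σ x ≈ σ y
    σ-cong x≈y = +-cong x≈y (reflexive (≡.cong (_· v) (character-cong x≈y)))

    σ-involutive : ∀ x → σ (σ x) ≈ x
    σ-involutive x = begin
      σ x + character (σ x) · v  ≈⟨ +-cong refl (reflexive (≡.cong (_· v) (character-σ x))) ⟩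
      σ x + character x · v      ≈⟨ +-assoc x _ _ ⟩
      x + (character x · v + character x · v)  ≈⟨ x+[y+y]≈x x _ ⟩
      x                          ∎

    σ-+ : ∀ x y → σ (x + y) ≈ σ x + σ y
    σ-+ x y = begin
      (x + y) + character (x + y) · v             ≈⟨ +-cong refl (reflexive (≡.cong (_· v) (character-+ x y))) ⟩
      (x + y) + (character x xor character y) · v  ≈⟨ +-cong refl (·-xor (character x) (character y) v) ⟩
      (x + y) + (character x · v + character y · v)
        ≈⟨ solve 4 (λ x y a b → (x ⊕ y) ⊕ (a ⊕ b) ⊜ (x ⊕ a) ⊕ (y ⊕ b)) refl x y _ _ ⟩
      σ x + σ y                                    ∎

    σ-0 : σ 0# ≈ 0#
    σ-0 = trans (+-cong refl (reflexive (≡.cong (_· v) character-0))) (+-identityʳ 0#)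

    σ-1 : σ 1# ≈ 1# + v
    σ-1 = +-cong refl (reflexive (≡.cong (_· v) character-1))

    shear : Involution
    shear = record { π = σ ; π-cong = σ-cong ; π-involutive = σ-involutive }

    -- Since σ fixes 0 and moves 1, it breaks every f with f(0, …, 0) = 1.
    breaks-unit : ∀ {k} (f : Op Carrier k) → Congruent f → f (λ _ → 0#) ≈ 1# → ¬ Preserves shear (fun k f)
    breaks-unit f f-cong f0≈1 = broken shear (λ _ → 0#) v v≉0 (begin
      σ (f (λ _ → 0#))        ≈⟨ σ-cong f0≈1 ⟩
      σ 1#                    ≈⟨ σ-1 ⟩
      1# + v                  ≈⟨ +-cong (sym f0≈1) refl ⟩
      f (λ _ → 0#) + v        ≈⟨ +-cong (f-cong _ _ (λ _ → sym σ-0)) refl ⟩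
      f (λ _ → σ 0#) + v      ∎)

    shear-reflects : ∀ c → Reflects (Preserves shear ⟦ c ⟧) (no-constant c)
    shear-reflects c0  = ofʸ (λ _ → σ-0)
    shear-reflects c1  = ofⁿ (breaks-unit _ (canonical-cong c1) refl)
    shear-reflects cx  = ofʸ (λ _ → refl)
    shear-reflects c¬x = ofⁿ (breaks-unit _ (canonical-cong c¬x) (+-identityˡ 1#))
    shear-reflects c+₀ = ofʸ (λ _ → σ-+ _ _)
    shear-reflects c+₁ = ofⁿ (breaks-unit _ (canonical-cong c+₁)
      (trans (+-cong (+-identityʳ 0#) refl) (+-identityˡ 1#)))
    shear-reflects cΣ  = ofʸ (λ _ → trans (σ-+ _ _) (+-cong (σ-+ _ _) refl))
    shear-reflects cΣ₁ = ofⁿ (breaks-unit _ (canonical-cong cΣ₁)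
      (trans (+-cong (trans (+-identityʳ _) (+-identityʳ 0#)) refl) (+-identityˡ 1#)))

  swap : Carrier → Carrier → Carrier → Carrier
  swap u v x with x ≟B u | x ≟B v
  ... | yes _ | _     = v
  ... | no _  | yes _ = u
  ... | no _  | no _  = x

  module _ {u v : Carrier} where

    swap-left : ∀ {x} → x ≈ u → swap u v x ≈ v
    swap-left {x} x≈u with x ≟B u | x ≟B v
    ... | yes _   | _     = refl
    ... | no  x≉u | _     = ⊥-elim (x≉u x≈u)

    swap-right : ∀ {x} → x ≈ v → swap u v x ≈ u
    swap-right {x} x≈v with x ≟B u | x ≟B v
    ... | yes x≈u | _       = trans (sym x≈v) x≈u
    ... | no  _   | yes _   = refl
    ... | no  _   | no  x≉v = ⊥-elim (x≉v x≈v)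

    swap-other : ∀ {x} → ¬ x ≈ u → ¬ x ≈ v → swap u v x ≈ x
    swap-other {x} x≉u x≉v with x ≟B u | x ≟B v
    ... | yes x≈u | _       = ⊥-elim (x≉u x≈u)
    ... | no  _   | yes x≈v = ⊥-elim (x≉v x≈v)
    ... | no  _   | no  _   = refl

    swap-cong : ∀ {x y} → x ≈ y → swap u v x ≈ swap u v y
    swap-cong {x} {y} x≈y with x ≟B u | x ≟B v
    ... | yes x≈u | _       = sym (swap-left (trans (sym x≈y) x≈u))
    ... | no  _   | yes x≈v = sym (swap-right (trans (sym x≈y) x≈v))
    ... | no  x≉u | no  x≉v =
      trans x≈y (sym (swap-other (λ y≈u → x≉u (trans x≈y y≈u)) (λ y≈v → x≉v (trans x≈y y≈v))))

    swap-involutive : ∀ x → swap u v (swap u v x) ≈ x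
    swap-involutive x with x ≟B u | x ≟B v
    ... | yes x≈u | _       = trans (swap-right refl) (sym x≈u)
    ... | no  _   | yes x≈v = trans (swap-left refl) (sym x≈v)
    ... | no  x≉u | no  x≉v = swap-other x≉u x≉v

  swap-complement : ∀ u x → swap u (u + 1#) (x + 1#) ≈ swap u (u + 1#) x + 1#
  swap-complement u x with x ≟B u | x ≟B (u + 1#)
  ... | yes x≈u | _         = trans (swap-right (+-cong x≈u refl)) (sym (x+1+1≈x u))
  ... | no  _   | yes x≈u+1 = swap-left (trans (+-cong x≈u+1 refl) (x+1+1≈x u))
  ... | no  x≉u | no  x≉u+1 = swap-other
    (λ x+1≈u → x≉u+1 (x+y≈z⇒x≈z+y x 1# u x+1≈u))
    (λ x+1≈u+1 → x≉u (x+1≈y+1⇒x≈y x+1≈u+1))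

  -- For m, n in general position, the transposition ρ of m and m + 1 fixes 0, 1
  -- and commutes with complementation, but moves m while fixing n and m + n.
  module Transposition (E : GeneralPosition) where
    open GeneralPosition E

    ρ : Carrier → Carrier
    ρ = swap m (m + 1#)

    transposition : Involution
    transposition = record { π = ρ ; π-cong = swap-cong ; π-involutive = swap-involutive }

    ρ-0 : ρ 0# ≈ 0#
    ρ-0 = swap-other (λ 0≈m → m≉0 (sym 0≈m))
                     (λ 0≈m+1 → m≉1 (trans (x+y≈z⇒x≈z+y m 1# 0# (sym 0≈m+1)) (+-identityˡ 1#)))

    ρ-1 : ρ 1# ≈ 1#
    ρ-1 = swap-other (λ 1≈m → m≉1 (sym 1≈m))
                     (λ 1≈m+1 → m≉0 (x+1≈y+1⇒x≈y (sym (trans (+-identityˡ 1#) 1≈m+1))))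

    ρ-m+n : ρ (m + n) ≈ m + n
    ρ-m+n = swap-other (λ m+n≈m → n≉0 (x+d≈x⇒d≈0 m n m+n≈m))
                       (λ m+n≈m+1 → n≉1 (∙-cancelˡ m n 1# m+n≈m+1))

    ρm+ρn : ρ m + ρ n ≈ (m + n) + 1#
    ρm+ρn = begin
      ρ m + ρ n         ≈⟨ +-cong (swap-left refl) (swap-other n≉m n≉m+1) ⟩
      (m + 1#) + n      ≈⟨ solve 3 (λ m o n → (m ⊕ o) ⊕ n ⊜ (m ⊕ n) ⊕ o) refl m 1# n ⟩
      (m + n) + 1#      ∎

    breaks : ∀ {k} (f : Op Carrier k) xs {w} → f xs ≈ w → ρ w ≈ w → f (ρ ∘ xs) ≈ w + 1# →
             ¬ Preserves transposition (fun k f)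
    breaks f xs {w} fxs≈w ρw≈w fρxs≈w+1 = broken transposition xs 1# 1≉0 (begin
      ρ (f xs)            ≈⟨ swap-cong fxs≈w ⟩
      ρ w                 ≈⟨ ρw≈w ⟩
      w                   ≈⟨ sym (x+1+1≈x w) ⟩
      (w + 1#) + 1#       ≈⟨ +-cong (sym fρxs≈w+1) refl ⟩
      f (ρ ∘ xs) + 1#     ∎)

    m,n : Fin 2 → Carrier
    m,n = extend m λ _ → n

    m,n,0 : Fin 3 → Carrier
    m,n,0 = extend m (extend n λ _ → 0#)

    transposition-reflects : ∀ c → Reflects (Preserves transposition ⟦ c ⟧) (at-most-unary c)
    transposition-reflects c0  = ofʸ (λ _ → ρ-0)
    transposition-reflects c1  = ofʸ (λ _ → ρ-1)
    transposition-reflects cx  = ofʸ (λ _ → refl)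
    transposition-reflects c¬x = ofʸ (λ xs → swap-complement m (xs zero))
    transposition-reflects c+₀ = ofⁿ (breaks _ m,n refl ρ-m+n ρm+ρn)
    transposition-reflects c+₁ =
      ofⁿ (breaks _ m,n refl (trans (swap-complement m _) (+-cong ρ-m+n refl)) (+-cong ρm+ρn refl))
    transposition-reflects cΣ  =
      ofⁿ (breaks _ m,n,0 (+-identityʳ _) ρ-m+n (trans (+-cong ρm+ρn ρ-0) (+-identityʳ _)))
    transposition-reflects cΣ₁ =
      ofⁿ (breaks _ m,n,0 (+-cong (+-identityʳ _) refl) (trans (swap-complement m _) (+-cong ρ-m+n refl))
                  (+-cong (trans (+-cong ρm+ρn ρ-0) (+-identityʳ _)) refl))

  bit-agrees : ∀ {F} I (bit : Canonical → Bool) → Congruent (Fun.op F) →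
               (∀ c → Reflects (Preserves I ⟦ c ⟧) (bit c)) →
               ∀ {c c′} → Interdefinable F ⟦ c ⟧ → Interdefinable F ⟦ c′ ⟧ → bit c ≡ bit c′
  bit-agrees I bit F-cong reflects {c} {c′} F~c F~c′ = det (reflects-⇔ c⇔c′ (reflects c)) (reflects c′)
    where
    c⇔c′ : Preserves I ⟦ c ⟧ ⇔ Preserves I ⟦ c′ ⟧
    c⇔c′ = ⇔-trans (⇔-sym (interdefinable-preserved I F-cong (canonical-cong c) F~c))
                   (interdefinable-preserved I F-cong (canonical-cong c′) F~c′)

  profile : Canonical → Bool × Bool × Bool
  profile c = odd-arity c , no-constant c , at-most-unary c

  decode : Bool × Bool × Bool → Canonical
  decode (false , true  , true ) = c0
  decode (false , false , true ) = c1
  decode (true  , true  , true ) = cx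
  decode (true  , false , true ) = c¬x
  decode (false , true  , false) = c+₀
  decode (false , false , false) = c+₁
  decode (true  , true  , false) = cΣ
  decode (true  , false , false) = cΣ₁

  decode-profile : ∀ c → decode (profile c) ≡ c
  decode-profile c0  = ≡.refl
  decode-profile c1  = ≡.refl
  decode-profile cx  = ≡.refl
  decode-profile c¬x = ≡.refl
  decode-profile c+₀ = ≡.refl
  decode-profile c+₁ = ≡.refl
  decode-profile cΣ  = ≡.refl
  decode-profile cΣ₁ = ≡.refl

  profile-injective : ∀ {c c′} → profile c′ ≡ profile c → c′ ≡ c
  profile-injective {c} {c′} same =
    ≡.trans (≡.sym (decode-profile c′)) (≡.trans (≡.cong decode same) (decode-profile c))

  -- The shear and transposition bits need elements in general position, which
  -- exist only up to double negation; equality of bits is decidable, hence stable.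
  uniqueness : ∀ {F} → Congruent (Fun.op F) → ∀ {c c′} →
               Interdefinable F ⟦ c ⟧ → Interdefinable F ⟦ c′ ⟧ → c′ ≡ c
  uniqueness F-cong {c} {c′} F~c F~c′ =
    profile-injective (≡.cong₂ _,_ odd-agrees (≡.cong₂ _,_ shear-agrees transposition-agrees))
    where
    odd-agrees : odd-arity c′ ≡ odd-arity c
    odd-agrees = bit-agrees complement odd-arity F-cong complement-reflects F~c′ F~c

    shear-agrees : no-constant c′ ≡ no-constant c
    shear-agrees =
      decidable-stable (no-constant c′ ≟ no-constant c) (¬¬-map agrees general-position)
      where
      agrees : GeneralPosition → no-constant c′ ≡ no-constant c
      agrees E = bit-agrees shear no-constant F-cong shear-reflects F~c′ F~c
        where
        open GeneralPosition E
        open Shear (shear-vector m m≉0 m≉1)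

    transposition-agrees : at-most-unary c′ ≡ at-most-unary c
    transposition-agrees =
      decidable-stable (at-most-unary c′ ≟ at-most-unary c) (¬¬-map agrees general-position)
      where
      agrees : GeneralPosition → at-most-unary c′ ≡ at-most-unary c
      agrees E = bit-agrees transposition at-most-unary F-cong transposition-reflects F~c′ F~c
        where open Transposition E

lemma3p1 : (B : CountableAtomlessBR) → let open Semantics B in
    (k : ℕ) (α : Bool) →
      Σ Canonical λ c →
        Interdefinable (linear k α) ⟦ c ⟧ ×
        (∀ c′ → Interdefinable (linear k α) ⟦ c′ ⟧ → c′ ≡ c)
lemma3p1 B k α =
  let open Proof B
      (c , l~c) = existence k α
  in c , l~c , λ c′ l~c′ → uniqueness (linear-cong k α) l~c l~c′
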